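{- Let $\mathcal B$ be a pre-matroid on a finite set $X$ and let $\omega,\pi,a,z,\varepsilon$ be as in the context. If an almost-basis $A$ of $\mathcal B$ is branching, then $A$ is balanced.
   Context: A pre-matroid on a finite set $X$ is a non-empty set $\mathcal B$ of subsets of $X$ (bases). For $Y\subseteq X$, $x\notin Y$, $Y+x=Y\cup\{x\}$; for $y\in Y$, $Y-y=Y\setminus\{y\}$. An almost-basis is $B-x$ with $B\in\mathcal B$, $x\in B$; $U(D)=\{x\notin D: D+x\in\mathcal B\}$. For a linear order $\rho$ on $X$ and an almost-basis $D$, $\varphi_\rho(D)=D+\min_\rho U(D)$. Let $\omega$ be a linear order on $X$, $a\ne z$ elements consecutive for $\omega$ (nothing strictly between) with $a<_\omega z$, $\varepsilon$ the transposition of $X$ exchanging $a,z$ (acting on subsets elementwise), and $\pi$ the linear order agreeing with $\omega$ on all pairs except that $z<_\pi a$. An almost-basis $A$ is branching if $\varphi_\omega(A)\ne\varphi_\pi(A)$. An almost-basis $Q$ is balanced if $\varepsilon(Q)$ is an almost-basis, $\varepsilon(\varphi_\omega(Q))=\varphi_\pi(\varepsilon(Q))$ and $\varepsilon(\varphi_\pi(Q))=\varphi_\omega(\varepsilon(Q))$. -}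

module Defs where

open import Level using (0ℓ)
open import Data.Bool using (Bool; true; false; if_then_else_; not; _∧_)
open import Data.Nat using (ℕ)
open import Data.Fin using (Fin; _≟_)
open import Data.Fin.Subset using (Subset; _∈_; _∉_; _∪_; _─_; ⁅_⁆)
open import Data.Fin.Subset.Properties using (_∈?_)
open import Data.List using (List; foldl; allFin)
open import Data.Maybe using (Maybe; just; nothing; maybe)
open import Data.Product using (_×_; Σ; ∃; _,_)
open import Data.Sum using (_⊎_)
open import Data.Vec using (tabulate; lookup)
open import Relation.Binary using (Rel; Decidable; IsStrictTotalOrder)
open import Relation.Binary.PropositionalEquality using (_≡_; _≢_)
open import Relation.Nullary using (¬_; Dec; yes; no; ¬?)
open import Relation.Nullary.Decidable using (⌊_⌋; _×-dec_; _⊎-dec_)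
open import Relation.Unary using (Pred) renaming (Decidable to Decidable₁)

-- The finite ground set X is Fin n; subsets of X are Data.Fin.Subset.
-- A family of subsets (the candidate set of bases) is a decidable predicate.

PreMatroid : ∀ {n} → Pred (Subset n) 0ℓ → Set
PreMatroid 𝓑 = ∃ λ B → 𝓑 B

_+ₛ_ : ∀ {n} → Subset n → Fin n → Subset n
Y +ₛ x = Y ∪ ⁅ x ⁆

_-ₛ_ : ∀ {n} → Subset n → Fin n → Subset n
Y -ₛ y = Y ─ ⁅ y ⁆

AlmostBasis : ∀ {n} → Pred (Subset n) 0ℓ → Subset n → Set
AlmostBasis 𝓑 D = Σ _ λ B → 𝓑 B × Σ _ λ x → x ∈ B × D ≡ B -ₛ x

U? : ∀ {n} {𝓑 : Pred (Subset n) 0ℓ} → Decidable₁ 𝓑 → Subset n → Fin n → Bool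
U? 𝓑? D x = not ⌊ x ∈? D ⌋ ∧ ⌊ 𝓑? (D +ₛ x) ⌋

minBy : ∀ {n} {_<_ : Rel (Fin n) 0ℓ} → Decidable _<_ → (Fin n → Bool) → Maybe (Fin n)
minBy {n} _<?_ P = foldl step nothing (allFin n)
  where
  step : Maybe (Fin n) → Fin n → Maybe (Fin n)
  step nothing  x = if P x then just x else nothing
  step (just y) x = if P x ∧ ⌊ x <? y ⌋ then just x else just y

-- φ_ρ(D) = D + min_ρ U(D).  (For D with U(D) empty -- never the case for an
-- almost-basis -- the value D is a harmless default.)
φ : ∀ {n} {𝓑 : Pred (Subset n) 0ℓ} → Decidable₁ 𝓑 →
    {_<_ : Rel (Fin n) 0ℓ} → Decidable _<_ → Subset n → Subset n
φ 𝓑? <? D = maybe (D +ₛ_) D (minBy <? (U? 𝓑? D))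

τ : ∀ {n} → Fin n → Fin n → Fin n → Fin n
τ a z i = if ⌊ i ≟ a ⌋ then z else (if ⌊ i ≟ z ⌋ then a else i)

ε : ∀ {n} → Fin n → Fin n → Subset n → Subset n
ε a z Y = tabulate (λ i → lookup Y (τ a z i))

-- π: agrees with ω on all pairs except that z <π a (instead of a <ω z).
πRel : ∀ {n} → Rel (Fin n) 0ℓ → Fin n → Fin n → Rel (Fin n) 0ℓ
πRel _<ω_ a z x y = (x ≡ z × y ≡ a) ⊎ (x <ω y × ¬ (x ≡ a × y ≡ z))

πRel? : ∀ {n} {_<ω_ : Rel (Fin n) 0ℓ} → Decidable _<ω_ → (a z : Fin n) →
        Decidable (πRel _<ω_ a z)
πRel? <ω? a z x y = ((x ≟ z) ×-dec (y ≟ a)) ⊎-dec (<ω? x y ×-dec ¬? ((x ≟ a) ×-dec (y ≟ z)))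

module Setup {n : ℕ} (𝓑 : Pred (Subset n) 0ℓ) (𝓑? : Decidable₁ 𝓑)
             {_<ω_ : Rel (Fin n) 0ℓ} (ω : IsStrictTotalOrder _≡_ _<ω_)
             (a z : Fin n) where

  open IsStrictTotalOrder ω using () renaming (_<?_ to _<ω?_)

  φω φπ : Subset n → Subset n
  φω = φ 𝓑? _<ω?_
  φπ = φ 𝓑? (πRel? _<ω?_ a z)

  εₛ : Subset n → Subset n
  εₛ = ε a z

  Branching : Subset n → Set
  Branching A = AlmostBasis 𝓑 A × φω A ≢ φπ A

  Balanced : Subset n → Set
  Balanced Q = AlmostBasis 𝓑 Q × AlmostBasis 𝓑 (εₛ Q)
             × εₛ (φω Q) ≡ φπ (εₛ Q) × εₛ (φπ Q) ≡ φω (εₛ Q)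

-- The orders ω and π differ only on the pair {a, z}, and since a and z are
-- ω-consecutive, an element lies below a for ω exactly when it lies below z
-- for π.  Hence the ω- and π-minimum of any set coincide unless the set
-- contains both a and z, in which case they are a and z respectively.  So if
-- A is branching, then φ_ω(A) = A + a and φ_π(A) = A + z with a, z ∉ A; the
-- transposition ε then fixes A and exchanges A + a with A + z.
module Submission where

open import Defs
open import Level using (0ℓ)
open import Data.Bool using (Bool; true; false; if_then_else_; _∧_; _∨_)
open import Data.Nat using (ℕ)
open import Data.Fin using (Fin; zero; suc; _≟_)
open import Data.Fin.Subset using (Subset; _∪_; ⁅_⁆)
open import Data.Fin.Subset.Properties using (_∈?_)
open import Data.List using ([]; _∷_; foldl; allFin)
open import Data.List.Properties using (foldl-cong)
open import Data.Maybe using (Maybe; just; nothing; maybe)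
open import Data.Product using (_×_; _,_; proj₁)
open import Data.Sum using (_⊎_; inj₁; inj₂)
open import Data.Vec using (tabulate; lookup)
open import Data.Vec.Properties
  using (lookup∘tabulate; tabulate∘lookup; tabulate-cong; lookup-zipWith; lookup-replicate; lookup⇒[]=)
open import Function using (_∘′_; _⇔_; mk⇔)
open import Relation.Binary using (Rel; Decidable; IsStrictTotalOrder; tri<; tri≈; tri>)
open import Relation.Binary.PropositionalEquality
open import Relation.Nullary using (¬_; Dec; yes; no; contradiction)
open import Relation.Nullary.Decidable
  using (⌊_⌋; isYes≗does; dec-true; dec-false; does-⇔; ⌊⌋-map′; _×-dec_)
open import Relation.Unary using (Pred) renaming (Decidable to Decidable₁)

isYes-true : ∀ {P : Set} (p? : Dec P) → P → ⌊ p? ⌋ ≡ true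
isYes-true p? p = trans (isYes≗does p?) (dec-true p? p)

isYes-false : ∀ {P : Set} (p? : Dec P) → ¬ P → ⌊ p? ⌋ ≡ false
isYes-false p? ¬p = trans (isYes≗does p?) (dec-false p? ¬p)

isYes-⇔ : ∀ {P Q : Set} → P ⇔ Q → (p? : Dec P) (q? : Dec Q) → ⌊ p? ⌋ ≡ ⌊ q? ⌋
isYes-⇔ P⇔Q p? q? = trans (isYes≗does p?) (trans (does-⇔ P⇔Q p? q?) (sym (isYes≗does q?)))

lookup-⁅⁆ : ∀ {n} (x y : Fin n) → lookup ⁅ y ⁆ x ≡ ⌊ x ≟ y ⌋
lookup-⁅⁆ zero    zero    = refl
lookup-⁅⁆ zero    (suc y) = refl
lookup-⁅⁆ (suc x) zero    = lookup-replicate x false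
lookup-⁅⁆ (suc x) (suc y) = trans (lookup-⁅⁆ x y) (sym (⌊⌋-map′ _ _ (x ≟ y)))

lookup-ext : ∀ {n} {X Y : Subset n} → (∀ i → lookup X i ≡ lookup Y i) → X ≡ Y
lookup-ext {X = X} {Y} X≗Y =
  trans (sym (tabulate∘lookup X)) (trans (tabulate-cong X≗Y) (tabulate∘lookup Y))

U?⇒∉ : ∀ {n} {𝓑 : Pred (Subset n) 0ℓ} (𝓑? : Decidable₁ 𝓑) (D : Subset n) (x : Fin n) →
       U? 𝓑? D x ≡ true → lookup D x ≡ false
U?⇒∉ 𝓑? D x x∈U with lookup D x in eq
... | false = refl
... | true with x ∈? D
...   | yes _ = contradiction x∈U λ ()
...   | no x∉D = contradiction (lookup⇒[]= x D eq) x∉D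

module Transposition {n : ℕ} (a z : Fin n) (a≢z : a ≢ z) where

  τ-a : τ a z a ≡ z
  τ-a rewrite isYes-true (a ≟ a) refl = refl

  τ-z : τ a z z ≡ a
  τ-z rewrite isYes-false (z ≟ a) (a≢z ∘′ sym) | isYes-true (z ≟ z) refl = refl

  τ-fix : ∀ i → i ≢ a → i ≢ z → τ a z i ≡ i
  τ-fix i i≢a i≢z rewrite isYes-false (i ≟ a) i≢a | isYes-false (i ≟ z) i≢z = refl

  data Position (i : Fin n) : Set where
    at-a  : i ≡ a → Position i
    at-z  : i ≡ z → Position i
    other : i ≢ a → i ≢ z → Position i

  position : ∀ i → Position i
  position i with i ≟ a | i ≟ z
  ... | yes i≡a | _       = at-a i≡a
  ... | no _    | yes i≡z = at-z i≡z
  ... | no i≢a  | no i≢z  = other i≢a i≢z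

  τ-involutive : ∀ i → τ a z (τ a z i) ≡ i
  τ-involutive i with position i
  ... | at-a refl        rewrite τ-a = τ-z
  ... | at-z refl        rewrite τ-z = τ-a
  ... | other i≢a i≢z   rewrite τ-fix i i≢a i≢z = τ-fix i i≢a i≢z

  τ-≡-swap : ∀ i u → τ a z i ≡ u ⇔ i ≡ τ a z u
  τ-≡-swap i u = mk⇔ (λ τi≡u → trans (sym (τ-involutive i)) (cong (τ a z) τi≡u))
                     (λ i≡τu → trans (cong (τ a z) i≡τu) (τ-involutive u))

  lookup-ε : ∀ (Y : Subset n) i → lookup (ε a z Y) i ≡ lookup Y (τ a z i)
  lookup-ε Y i = lookup∘tabulate _ i

  ε-∪ : ∀ (X Y : Subset n) → ε a z (X ∪ Y) ≡ ε a z X ∪ ε a z Y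
  ε-∪ X Y = lookup-ext λ i → begin
    lookup (ε a z (X ∪ Y)) i                     ≡⟨ lookup-ε (X ∪ Y) i ⟩
    lookup (X ∪ Y) (τ a z i)                     ≡⟨ lookup-zipWith _∨_ (τ a z i) X Y ⟩
    lookup X (τ a z i) ∨ lookup Y (τ a z i)      ≡⟨ sym (cong₂ _∨_ (lookup-ε X i) (lookup-ε Y i)) ⟩
    lookup (ε a z X) i ∨ lookup (ε a z Y) i      ≡⟨ sym (lookup-zipWith _∨_ i (ε a z X) (ε a z Y)) ⟩
    lookup (ε a z X ∪ ε a z Y) i                 ∎
    where open ≡-Reasoning

  ε-⁅⁆ : ∀ u → ε a z ⁅ u ⁆ ≡ ⁅ τ a z u ⁆
  ε-⁅⁆ u = lookup-ext λ i → begin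
    lookup (ε a z ⁅ u ⁆) i   ≡⟨ lookup-ε ⁅ u ⁆ i ⟩
    lookup ⁅ u ⁆ (τ a z i)   ≡⟨ lookup-⁅⁆ (τ a z i) u ⟩
    ⌊ τ a z i ≟ u ⌋          ≡⟨ isYes-⇔ (τ-≡-swap i u) (τ a z i ≟ u) (i ≟ τ a z u) ⟩
    ⌊ i ≟ τ a z u ⌋          ≡⟨ sym (lookup-⁅⁆ i (τ a z u)) ⟩
    lookup ⁅ τ a z u ⁆ i     ∎
    where open ≡-Reasoning

  ε-+ₛ : ∀ (Y : Subset n) u → ε a z (Y +ₛ u) ≡ ε a z Y +ₛ τ a z u
  ε-+ₛ Y u = trans (ε-∪ Y ⁅ u ⁆) (cong (ε a z Y ∪_) (ε-⁅⁆ u))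

  ε-fix : ∀ (Y : Subset n) → lookup Y a ≡ lookup Y z → ε a z Y ≡ Y
  ε-fix Y Ya≡Yz = lookup-ext λ i → trans (lookup-ε Y i) (Y∘τ≗Y i)
    where
    Y∘τ≗Y : ∀ i → lookup Y (τ a z i) ≡ lookup Y i
    Y∘τ≗Y i with position i
    ... | at-a refl      rewrite τ-a = sym Ya≡Yz
    ... | at-z refl      rewrite τ-z = Ya≡Yz
    ... | other i≢a i≢z  rewrite τ-fix i i≢a i≢z = refl

-- The step function of minBy, which Defs keeps local to a where block.
minStep : ∀ {n} {_<_ : Rel (Fin n) 0ℓ} → Decidable _<_ →
          (Fin n → Bool) → Maybe (Fin n) → Fin n → Maybe (Fin n)
minStep _<?_ P nothing  x = if P x then just x else nothing
minStep _<?_ P (just y) x = if P x ∧ ⌊ x <? y ⌋ then just x else just y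

minBy≡foldl-minStep : ∀ {n} {_<_ : Rel (Fin n) 0ℓ} (_<?_ : Decidable _<_) (P : Fin n → Bool) →
                      minBy _<?_ P ≡ foldl (minStep _<?_ P) nothing (allFin n)
minBy≡foldl-minStep {n} _<?_ P =
  foldl-cong (λ { nothing x → refl ; (just y) x → refl }) nothing (allFin n)

module SwappedOrder {n : ℕ} {_<ω_ : Rel (Fin n) 0ℓ} (ω : IsStrictTotalOrder _≡_ _<ω_)
                    (a z : Fin n) (a≢z : a ≢ z) (a<ωz : a <ω z)
                    (consecutive : ∀ c → ¬ (a <ω c × c <ω z)) where

  open IsStrictTotalOrder ω using (compare; asym; irrefl)
    renaming (_<?_ to _<ω?_; trans to <ω-trans)
  open Transposition a z a≢z using (at-a; at-z; other; position)

  _<π_ : Rel (Fin n) 0ℓ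
  _<π_ = πRel _<ω_ a z

  _<π?_ : Decidable _<π_
  _<π?_ = πRel? _<ω?_ a z

  z<πa : z <π a
  z<πa = inj₁ (refl , refl)

  a≮πz : ¬ a <π z
  a≮πz (inj₁ (a≡z , _)) = a≢z a≡z
  a≮πz (inj₂ (_ , ¬az)) = ¬az (refl , refl)

  z≮πz : ¬ z <π z
  z≮πz (inj₁ (_ , z≡a)) = a≢z (sym z≡a)
  z≮πz (inj₂ (z<z , _)) = irrefl refl z<z

  <ω⇔<π : ∀ {x y} → ¬ (x ≡ z × y ≡ a) → ¬ (x ≡ a × y ≡ z) → x <ω y ⇔ x <π y
  <ω⇔<π ¬za ¬az = mk⇔ (λ x<ωy → inj₂ (x<ωy , ¬az)) λ
    { (inj₁ za)         → contradiction za ¬za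
    ; (inj₂ (x<ωy , _)) → x<ωy
    }

  <ωa⇔<πz : ∀ {x} → x ≢ a → x ≢ z → x <ω a ⇔ x <π z
  <ωa⇔<πz {x} x≢a x≢z = mk⇔ (λ x<ωa → inj₂ (<ω-trans x<ωa a<ωz , x≢a ∘′ proj₁)) <πz⇒<ωa
    where
    <πz⇒<ωa : x <π z → x <ω a
    <πz⇒<ωa (inj₁ (x≡z , _)) = contradiction x≡z x≢z
    <πz⇒<ωa (inj₂ (x<ωz , _)) with compare x a
    ... | tri< x<ωa _ _ = x<ωa
    ... | tri≈ _ x≡a _  = contradiction x≡a x≢a
    ... | tri> _ _ a<ωx = contradiction (a<ωx , x<ωz) (consecutive x)

  data PairPosition (x y : Fin n) : Set where
    z-a       : x ≡ z → y ≡ a → PairPosition x y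
    a-z       : x ≡ a → y ≡ z → PairPosition x y
    unswapped : ¬ (x ≡ z × y ≡ a) → ¬ (x ≡ a × y ≡ z) → PairPosition x y

  pairPosition : ∀ x y → PairPosition x y
  pairPosition x y with (x ≟ z) ×-dec (y ≟ a) | (x ≟ a) ×-dec (y ≟ z)
  ... | yes (x≡z , y≡a) | _               = z-a x≡z y≡a
  ... | no ¬za          | yes (x≡a , y≡z) = a-z x≡a y≡z
  ... | no ¬za          | no ¬az          = unswapped ¬za ¬az

  module _ (P : Fin n → Bool) where

    data Coupled : Maybe (Fin n) → Maybe (Fin n) → Set where
      none  : Coupled nothing nothing
      same  : ∀ y → P y ≡ true → Coupled (just y) (just y)
      split : P a ≡ true → P z ≡ true → Coupled (just a) (just z)

    minStep-coupled : ∀ {s₁ s₂} x → Coupled s₁ s₂ →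
                      Coupled (minStep _<ω?_ P s₁ x) (minStep _<π?_ P s₂ x)
    minStep-coupled x none with P x in Px
    ... | true  = same x Px
    ... | false = none
    minStep-coupled x (same y Py) with P x in Px
    ... | false = same y Py
    ... | true with pairPosition x y
    ...   | z-a refl refl
      rewrite isYes-false (z <ω? a) (asym a<ωz) | isYes-true (z <π? a) z<πa = split Py Px
    ...   | a-z refl refl
      rewrite isYes-true (a <ω? z) a<ωz | isYes-false (a <π? z) a≮πz = split Px Py
    ...   | unswapped ¬za ¬az
      rewrite isYes-⇔ (<ω⇔<π ¬za ¬az) (x <ω? y) (x <π? y) with ⌊ x <π? y ⌋
    ...     | true  = same x Px
    ...     | false = same y Py
    minStep-coupled x (split Pa Pz) with P x in Px
    ... | false = split Pa Pz
    ... | true with position x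
    ...   | at-a refl
      rewrite isYes-false (a <ω? a) (irrefl refl) | isYes-false (a <π? z) a≮πz = split Pa Pz
    ...   | at-z refl
      rewrite isYes-false (z <ω? a) (asym a<ωz) | isYes-false (z <π? z) z≮πz = split Pa Pz
    ...   | other x≢a x≢z
      rewrite isYes-⇔ (<ωa⇔<πz x≢a x≢z) (x <ω? a) (x <π? z) with ⌊ x <π? z ⌋
    ...     | true  = same x Px
    ...     | false = split Pa Pz

    foldl-coupled : ∀ xs {s₁ s₂} → Coupled s₁ s₂ →
                    Coupled (foldl (minStep _<ω?_ P) s₁ xs) (foldl (minStep _<π?_ P) s₂ xs)
    foldl-coupled []       c = c
    foldl-coupled (x ∷ xs) c = foldl-coupled xs (minStep-coupled x c)

    coupled-outcome : ∀ {s₁ s₂} → Coupled s₁ s₂ →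
                      s₁ ≡ s₂ ⊎ (s₁ ≡ just a × s₂ ≡ just z × P a ≡ true × P z ≡ true)
    coupled-outcome none          = inj₁ refl
    coupled-outcome (same _ _)    = inj₁ refl
    coupled-outcome (split Pa Pz) = inj₂ (refl , refl , Pa , Pz)

    minBy-swap : minBy _<ω?_ P ≡ minBy _<π?_ P
               ⊎ (minBy _<ω?_ P ≡ just a × minBy _<π?_ P ≡ just z × P a ≡ true × P z ≡ true)
    minBy-swap rewrite minBy≡foldl-minStep _<ω?_ P | minBy≡foldl-minStep _<π?_ P =
      coupled-outcome (foldl-coupled (allFin n) none)

lemma8p1 : {n : ℕ} (𝓑 : Pred (Subset n) 0ℓ) (𝓑? : Decidable₁ 𝓑) → PreMatroid 𝓑 →
           {_<ω_ : Rel (Fin n) 0ℓ} (ω : IsStrictTotalOrder _≡_ _<ω_) →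
           (a z : Fin n) → a ≢ z → a <ω z → (∀ c → ¬ (a <ω c × c <ω z)) →
           (A : Subset n) →
           Setup.Branching 𝓑 𝓑? ω a z A → Setup.Balanced 𝓑 𝓑? ω a z A
lemma8p1 {n} 𝓑 𝓑? _ ω a z a≢z a<ωz consecutive A (A-almost , φωA≢φπA)
  with SwappedOrder.minBy-swap ω a z a≢z a<ωz consecutive (U? 𝓑? A)
... | inj₁ minω≡minπ = contradiction (cong (maybe (A +ₛ_) A) minω≡minπ) φωA≢φπA
... | inj₂ (minω≡a , minπ≡z , a∈U , z∈U) =
  A-almost , subst (AlmostBasis 𝓑) (sym εA≡A) A-almost ,
  ε-exchange φω φπ a φωA≡A+a φπA≡A+z τ-a , ε-exchange φπ φω z φπA≡A+z φωA≡A+a τ-z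
  where
  open Transposition a z a≢z using (τ-a; τ-z; ε-fix; ε-+ₛ)
  open Setup 𝓑 𝓑? ω a z using (φω; φπ; εₛ)
  open ≡-Reasoning

  φωA≡A+a : φω A ≡ A +ₛ a
  φωA≡A+a = cong (maybe (A +ₛ_) A) minω≡a

  φπA≡A+z : φπ A ≡ A +ₛ z
  φπA≡A+z = cong (maybe (A +ₛ_) A) minπ≡z

  εA≡A : εₛ A ≡ A
  εA≡A = ε-fix A (trans (U?⇒∉ 𝓑? A a a∈U) (sym (U?⇒∉ 𝓑? A z z∈U)))

  ε-exchange : ∀ (φ ψ : Subset n → Subset n) u {v} →
               φ A ≡ A +ₛ u → ψ A ≡ A +ₛ v → τ a z u ≡ v → εₛ (φ A) ≡ ψ (εₛ A)
  ε-exchange φ ψ u {v} φA≡A+u ψA≡A+v τu≡v = begin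
    εₛ (φ A)            ≡⟨ cong εₛ φA≡A+u ⟩
    εₛ (A +ₛ u)         ≡⟨ ε-+ₛ A u ⟩
    εₛ A +ₛ τ a z u     ≡⟨ cong₂ _+ₛ_ εA≡A τu≡v ⟩
    A +ₛ v              ≡⟨ sym ψA≡A+v ⟩
    ψ A                 ≡⟨ cong ψ (sym εA≡A) ⟩
    ψ (εₛ A)            ∎
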